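{- For fixed positive integers $k$ and $d_1,\dots,d_s$, the $k$-$L(d_1,\dots,d_s)$-Labeling problem is expressible in DN logic: there is a DN sentence $\varphi$ such that for every graph $G$, $G\models\varphi$ if and only if $G$ has a $k$-$L(d_1,\dots,d_s)$-labeling.
   Context: A $k$-$L(d_1,\dots,d_s)$-labeling of a graph $G$ is a map $c\colon V(G)\to\{1,\dots,k\}$ such that for all $i\in\{1,\dots,s\}$ and all distinct $u,v\in V(G)$ with $\mathrm{dist}_G(u,v)\le i$, $|c(u)-c(v)|\ge d_i$. DN logic: existential MSO over (vertex-colored) graphs (quantification over vertices and vertex sets; atomic $E(x,y)$, $x=y$, $x\in X$, $\mathbf P(x)$; only existential quantifiers; negation only of quantifier-free formulas) extended by size measurements $|t|=m,|t|\le m,|t|\ge m$ and comparisons $t_1=t_2$, $t_1\subseteq t_2$, $t_1\supseteq t_2$ of neighborhood terms, which are built from set variables, unary relation symbols and $\emptyset$ by complement, $\cap$, $\cup$, $\setminus$ and $N^r_d(\cdot)$ ($d,r\in\mathbb N^+$), where $N^r_d(U)$ is the set of vertices $v$ having at least $d$ vertices of $U$ among $\{u\ne v:\mathrm{dist}(u,v)\le r\}$. -}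

module Defs where

open import Data.Nat using (ℕ; zero; suc; _≤_; _≤ᵇ_; ∣_-_∣; NonZero)
open import Data.Bool using (Bool; true; false; _∧_; _∨_; not)
open import Data.Fin using (Fin; toℕ)
open import Data.Fin.Properties using (_≟_)
open import Data.Fin.Subset using (Subset; ∁; _∩_; _∪_; _─_; _⊆_; _⊇_; ∣_∣; ⊥)
open import Data.Vec using (Vec; []; _∷_; lookup; tabulate)
open import Data.List using (List)
open import Data.List.Relation.Unary.Any using (Any)
open import Data.Product using (Σ; _×_; ∃; ∃-syntax)
open import Data.Sum using (_⊎_)
open import Relation.Nullary using (¬_)
open import Relation.Nullary.Decidable using (⌊_⌋)
open import Relation.Binary.PropositionalEquality using (_≡_; _≢_)

record ColGraph (p : ℕ) : Set where
  field
    n      : ℕ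
    adj    : Fin n → Fin n → Bool
    sym    : ∀ u v → adj u v ≡ adj v u
    irrefl : ∀ u → adj u u ≡ false
    col    : Fin p → Fin n → Bool
open ColGraph public

record Graph : Set where
  field
    n      : ℕ
    adj    : Fin n → Fin n → Bool
    sym    : ∀ u v → adj u v ≡ adj v u
    irrefl : ∀ u → adj u u ≡ false

plain : Graph → ColGraph 0
plain G = record
  { n = Graph.n G ; adj = Graph.adj G ; sym = Graph.sym G
  ; irrefl = Graph.irrefl G ; col = λ () }

data Walk (G : Graph) : Fin (Graph.n G) → Fin (Graph.n G) → ℕ → Set where
  here : ∀ {u} → Walk G u u 0
  step : ∀ {u w v ℓ} → Graph.adj G u w ≡ true → Walk G w v ℓ → Walk G u v (suc ℓ)

DistLE : (G : Graph) → ℕ → Fin (Graph.n G) → Fin (Graph.n G) → Set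
DistLE G i u v = ∃[ ℓ ] (ℓ ≤ i × Walk G u v ℓ)

-- k-L(d_1,…,d_s)-labelings.  Labels {1,…,k} are represented by Fin k
-- (label j+1 ↦ j); only differences of labels matter.  ds = (d_1,…,d_s),
-- index i : Fin s stands for distance bound toℕ i + 1.

IsLabeling : (G : Graph) (k : ℕ) {s : ℕ} (ds : Vec ℕ s) →
             (Fin (Graph.n G) → Fin k) → Set
IsLabeling G k {s} ds c =
  ∀ (i : Fin s) (u v : Fin (Graph.n G)) → u ≢ v →
    DistLE G (suc (toℕ i)) u v →
    lookup ds i ≤ ∣ toℕ (c u) - toℕ (c v) ∣

HasLabeling : (G : Graph) (k : ℕ) {s : ℕ} (ds : Vec ℕ s) → Set
HasLabeling G k ds = Σ (Fin (Graph.n G) → Fin k) (IsLabeling G k ds)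

-- DN logic over p-colored graphs.
-- Formulas are in de Bruijn style: Formula p a b has a free vertex
-- variables (Fin a) and b free set variables (Fin b).

-- Quantifier-free MSO formulas (the only ones that may be negated).
data QF (p a b : ℕ) : Set where
  edge  : Fin a → Fin a → QF p a b
  eq    : Fin a → Fin a → QF p a b
  mem   : Fin a → Fin b → QF p a b
  pred  : Fin p → Fin a → QF p a b
  neg   : QF p a b → QF p a b
  and   : QF p a b → QF p a b → QF p a b
  or    : QF p a b → QF p a b → QF p a b

data Term (p b : ℕ) : Set where
  svar   : Fin b → Term p b
  upred  : Fin p → Term p b
  empty  : Term p b
  compl  : Term p b → Term p b
  inter  : Term p b → Term p b → Term p b
  union  : Term p b → Term p b → Term p b
  diff   : Term p b → Term p b → Term p b
  nbhd   : (d r : ℕ) → .{{NonZero d}} → .{{NonZero r}} →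
           Term p b → Term p b

data Formula (p : ℕ) : ℕ → ℕ → Set where
  qf      : ∀ {a b} → QF p a b → Formula p a b
  and     : ∀ {a b} → Formula p a b → Formula p a b → Formula p a b
  or      : ∀ {a b} → Formula p a b → Formula p a b → Formula p a b
  ex-v    : ∀ {a b} → Formula p (suc a) b → Formula p a b   -- ∃x (new var = index 0)
  ex-s    : ∀ {a b} → Formula p a (suc b) → Formula p a b   -- ∃X (new var = index 0)
  size=   : ∀ {a b} → Term p b → ℕ → Formula p a b
  size≤   : ∀ {a b} → Term p b → ℕ → Formula p a b
  size≥   : ∀ {a b} → Term p b → ℕ → Formula p a b
  teq     : ∀ {a b} → Term p b → Term p b → Formula p a b
  tsub    : ∀ {a b} → Term p b → Term p b → Formula p a b
  tsup    : ∀ {a b} → Term p b → Term p b → Formula p a b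

Sentence : ℕ → Set
Sentence p = Formula p 0 0

anyFin : ∀ {m} → (Fin m → Bool) → Bool
anyFin {zero}  f = false
anyFin {suc m} f = f Data.Fin.zero ∨ anyFin (λ i → f (Data.Fin.suc i))

module _ {p : ℕ} (G : ColGraph p) where
  private
    V = Fin (n G)

  _==_ : V → V → Bool
  u == v = ⌊ u ≟ v ⌋

  reach : ℕ → V → V → Bool
  reach zero    u v = u == v
  reach (suc r) u v = reach r u v ∨ anyFin (λ w → reach r u w ∧ adj G w v)

  N : ℕ → ℕ → Subset (n G) → Subset (n G)
  N d r U = tabulate λ v →
    d ≤ᵇ ∣ tabulate (λ u → not (u == v) ∧ reach r u v ∧ lookup U u) ∣

  ⟦_⟧t : ∀ {b} → Term p b → Vec (Subset (n G)) b → Subset (n G)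
  ⟦ svar X ⟧t σ = lookup σ X
  ⟦ upred P ⟧t σ = tabulate (col G P)
  ⟦ empty ⟧t σ = ⊥
  ⟦ compl t ⟧t σ = ∁ (⟦ t ⟧t σ)
  ⟦ inter t₁ t₂ ⟧t σ = ⟦ t₁ ⟧t σ ∩ ⟦ t₂ ⟧t σ
  ⟦ union t₁ t₂ ⟧t σ = ⟦ t₁ ⟧t σ ∪ ⟦ t₂ ⟧t σ
  ⟦ diff t₁ t₂ ⟧t σ = ⟦ t₁ ⟧t σ ─ ⟦ t₂ ⟧t σ
  ⟦ nbhd d r t ⟧t σ = N d r (⟦ t ⟧t σ)

  ⟦_⟧q : ∀ {a b} → QF p a b → Vec V a → Vec (Subset (n G)) b → Bool
  ⟦ edge x y ⟧q ρ σ = adj G (lookup ρ x) (lookup ρ y)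
  ⟦ eq x y ⟧q ρ σ = lookup ρ x == lookup ρ y
  ⟦ mem x X ⟧q ρ σ = lookup (lookup σ X) (lookup ρ x)
  ⟦ pred P x ⟧q ρ σ = col G P (lookup ρ x)
  ⟦ neg φ ⟧q ρ σ = not (⟦ φ ⟧q ρ σ)
  ⟦ and φ ψ ⟧q ρ σ = ⟦ φ ⟧q ρ σ ∧ ⟦ ψ ⟧q ρ σ
  ⟦ or φ ψ ⟧q ρ σ = ⟦ φ ⟧q ρ σ ∨ ⟦ ψ ⟧q ρ σ

  Sat : ∀ {a b} → Formula p a b → Vec V a → Vec (Subset (n G)) b → Set
  Sat (qf φ) ρ σ = ⟦ φ ⟧q ρ σ ≡ true
  Sat (and φ ψ) ρ σ = Sat φ ρ σ × Sat ψ ρ σ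
  Sat (or φ ψ) ρ σ = Sat φ ρ σ ⊎ Sat ψ ρ σ
  Sat (ex-v φ) ρ σ = ∃[ x ] Sat φ (x ∷ ρ) σ
  Sat (ex-s φ) ρ σ = ∃[ X ] Sat φ ρ (X ∷ σ)
  Sat (size= t m) ρ σ = ∣ ⟦ t ⟧t σ ∣ ≡ m
  Sat (size≤ t m) ρ σ = ∣ ⟦ t ⟧t σ ∣ ≤ m
  Sat (size≥ t m) ρ σ = m ≤ ∣ ⟦ t ⟧t σ ∣
  Sat (teq t₁ t₂) ρ σ = ⟦ t₁ ⟧t σ ≡ ⟦ t₂ ⟧t σ
  Sat (tsub t₁ t₂) ρ σ = ⟦ t₁ ⟧t σ ⊆ ⟦ t₂ ⟧t σ
  Sat (tsup t₁ t₂) ρ σ = ⟦ t₁ ⟧t σ ⊇ ⟦ t₂ ⟧t σ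

  _⊨_ : Sentence p → Set
  _⊨_ φ = Sat φ [] []

-- Guess k vertex sets X₁,…,X_k, X_a meant as the vertices labelled a.  Every vertex must
-- lie in some class, and whenever |a − b| < d_i no vertex of class b may have another
-- vertex of class a within distance i, i.e. X_b ∩ N^i_1(X_a) = ∅.  The classes need not
-- be disjoint: choosing any class for each vertex still gives a labeling, so no
-- universally quantified exclusivity condition is needed and the whole sentence is
-- ∃X₁…∃X_k of a conjunction of neighborhood-term equations.

module Submission where

open import Defs hiding (sym)
open import Data.Nat using (ℕ; _≥_; zero; suc; _+_; _≤_; _≤?_; _≤ᵇ_; z≤n; s≤s; ∣_-_∣)
open import Data.Nat.Properties using (≤ᵇ⇒≤; ≤⇒≤ᵇ; m≤n⇒m≤1+n)
open import Data.Bool using (Bool; true; T; not; _∧_)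
open import Data.Bool.Properties using (T-≡; T-∧; T-∨)
open import Data.Fin using (Fin; toℕ; _↑ˡ_) renaming (zero to fzero; suc to fsuc)
open import Data.Fin.Properties using (_≟_)
open import Data.Fin.Subset using (Subset; _∈_; Nonempty; Empty; ⁅_⁆; ∣_∣; ⊥)
open import Data.Fin.Subset.Properties
  using (Empty-unique; nonempty?; ∉⊥; ∣⊥∣≡0; ∣⁅x⁆∣≡1; x∈⁅y⁆⇒x≡y; p⊆q⇒∣p∣≤∣q∣;
         x∈p∪q⁻; x∈p∪q⁺; x∈p∩q⁺; x∈p∩q⁻; x∈∁p⇒x∉p; x∉∁p⇒x∈p)
open import Data.Vec using (Vec; []; _∷_; lookup; tabulate; _++_)
open import Data.Vec.Properties using (lookup∘tabulate; lookup-++ˡ; []=⇒lookup; lookup⇒[]=)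
open import Data.Vec.Relation.Unary.All using (All)
open import Data.Product using (Σ; _×_; _,_; proj₁; proj₂; ∃; ∃-syntax)
open import Data.Sum using (_⊎_; inj₁; inj₂)
import Data.Sum as Sum
open import Function using (_∘_; id)
open import Function.Bundles using (_⇔_; mk⇔; Equivalence)
open import Function.Construct.Composition using (_⇔-∘_)
open import Relation.Nullary using (¬_; Dec; yes; no; ⌊_⌋; contradiction)
open import Relation.Nullary.Decidable
  using (toWitness; fromWitness; toWitnessFalse; fromWitnessFalse; decidable-stable)
open import Relation.Binary.PropositionalEquality
  using (_≡_; _≢_; refl; sym; subst; subst₂)

open Equivalence using (to; from)

∈⇔T-lookup : ∀ {n} {U : Subset n} {x} → x ∈ U ⇔ T (lookup U x)
∈⇔T-lookup = mk⇔ (from T-≡ ∘ []=⇒lookup) (lookup⇒[]= _ _ ∘ to T-≡)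

∈-tabulate : ∀ {n} {f : Fin n → Bool} {x} → x ∈ tabulate f ⇔ T (f x)
∈-tabulate {f = f} {x} = subst (λ b → x ∈ tabulate f ⇔ T b) (lookup∘tabulate f x) ∈⇔T-lookup

1≤∣U∣⇔Nonempty : ∀ {n} {U : Subset n} → 1 ≤ ∣ U ∣ ⇔ Nonempty U
1≤∣U∣⇔Nonempty {n} {U} = mk⇔ nonempty positive
  where
  nonempty : 1 ≤ ∣ U ∣ → Nonempty U
  nonempty 1≤∣U∣ with nonempty? U
  ... | yes ne = ne
  ... | no  em with subst (1 ≤_) (∣⊥∣≡0 n) (subst (λ V → 1 ≤ ∣ V ∣) (Empty-unique em) 1≤∣U∣)
  ... | ()
  positive : Nonempty U → 1 ≤ ∣ U ∣
  positive (x , x∈U) = subst (_≤ ∣ U ∣) (∣⁅x⁆∣≡1 x) (p⊆q⇒∣p∣≤∣q∣ ⁅x⁆⊆U)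
    where
    ⁅x⁆⊆U : ∀ {y} → y ∈ ⁅ x ⁆ → y ∈ U
    ⁅x⁆⊆U y∈⁅x⁆ = subst (_∈ U) (sym (x∈⁅y⁆⇒x≡y x y∈⁅x⁆)) x∈U

≡⊥⇔Empty : ∀ {n} {U : Subset n} → U ≡ ⊥ ⇔ Empty U
≡⊥⇔Empty = mk⇔ (λ { refl (x , x∈⊥) → ∉⊥ x∈⊥ }) Empty-unique

T-anyFin : ∀ {m} {f : Fin m → Bool} → T (anyFin f) ⇔ (∃[ i ] T (f i))
T-anyFin {zero}      = mk⇔ (λ ()) (λ ())
T-anyFin {suc m} {f} = mk⇔ witness (from T-∨ ∘ found)
  where
  witness : T (anyFin f) → ∃[ i ] T (f i)
  witness h with to T-∨ h
  ... | inj₁ h₀ = fzero , h₀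
  ... | inj₂ hs = let (i , hi) = to T-anyFin hs in fsuc i , hi
  found : ∃[ i ] T (f i) → T (f fzero) ⊎ T (anyFin (f ∘ fsuc))
  found (fzero  , h) = inj₁ h
  found (fsuc i , h) = inj₂ (from T-anyFin (i , h))

module _ {p : ℕ} (G : ColGraph p) where

  T-reach-suc : ∀ r u v → T (reach G (suc r) u v) ⇔
                (T (reach G r u v) ⊎ ∃[ w ] T (reach G r u w) × T (adj G w v))
  T-reach-suc r u v = mk⇔ (Sum.map₂ split ∘ to T-∨) (from T-∨ ∘ Sum.map₂ join)
    where
    via : Fin (n G) → Bool
    via w = reach G r u w ∧ adj G w v
    split : T (anyFin via) → ∃[ w ] T (reach G r u w) × T (adj G w v)
    split h = let (w , uwv) = to (T-anyFin {f = via}) h in w , to T-∧ uwv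
    join : ∃[ w ] T (reach G r u w) × T (adj G w v) → T (anyFin via)
    join (w , uw , wv) = from (T-anyFin {f = via}) (w , from T-∧ (uw , wv))

  ∈-N₁ : ∀ {r} {U : Subset (n G)} {v} →
         v ∈ N G 1 r U ⇔ (∃[ u ] u ≢ v × T (reach G r u v) × u ∈ U)
  ∈-N₁ {r} {U} {v} = mk⇔ to′ from′
    where
    near : Fin (n G) → Fin (n G) → Bool
    near v u = not (_==_ G u v) ∧ reach G r u v ∧ lookup U u

    ∈-N : v ∈ N G 1 r U ⇔ T (1 ≤ᵇ ∣ tabulate (near v) ∣)
    ∈-N = ∈-tabulate {f = λ w → 1 ≤ᵇ ∣ tabulate (near w) ∣}

    to′ : v ∈ N G 1 r U → ∃[ u ] u ≢ v × T (reach G r u v) × u ∈ U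
    to′ v∈N with to 1≤∣U∣⇔Nonempty (≤ᵇ⇒≤ 1 _ (to ∈-N v∈N))
    ... | u , u∈near with to T-∧ (to ∈-tabulate u∈near)
    ... | u≢v , rest with to T-∧ rest
    ... | reach-uv , u∈U = u , toWitnessFalse {a? = u ≟ v} u≢v , reach-uv , from ∈⇔T-lookup u∈U

    from′ : ∃[ u ] u ≢ v × T (reach G r u v) × u ∈ U → v ∈ N G 1 r U
    from′ (u , u≢v , reach-uv , u∈U) = from ∈-N (≤⇒≤ᵇ (from 1≤∣U∣⇔Nonempty (u , u∈near)))
      where
      u∈near : u ∈ tabulate (near v)
      u∈near = from ∈-tabulate
        (from T-∧ (fromWitnessFalse {a? = u ≟ v} u≢v , from T-∧ (reach-uv , to ∈⇔T-lookup u∈U)))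

module _ (G : Graph) where
  private
    H = plain G
    V = Fin (Graph.n G)

  walk-snoc : ∀ {u w v ℓ} → Walk G u w ℓ → Graph.adj G w v ≡ true → Walk G u v (suc ℓ)
  walk-snoc here        a = step a here
  walk-snoc (step a′ w) a = step a′ (walk-snoc w a)

  reach-refl : ∀ r (u : V) → T (reach H r u u)
  reach-refl zero    u = fromWitness {a? = u ≟ u} refl
  reach-refl (suc r) u = from T-∨ (inj₁ (reach-refl r u))

  reach-step : ∀ r {u w v : V} → Graph.adj G u w ≡ true → T (reach H r w v) →
               T (reach H (suc r) u v)
  reach-step zero {u} {w} {v} uw wv with toWitness {a? = w ≟ v} wv
  ... | refl = from (T-reach-suc H 0 u v) (inj₂ (u , reach-refl 0 u , from T-≡ uw))
  reach-step (suc r) {u} {w} {v} uw wv with to (T-reach-suc H r w v) wv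
  ... | inj₁ wv′ = from (T-reach-suc H (suc r) u v) (inj₁ (reach-step r uw wv′))
  ... | inj₂ (z , wz , zv) =
    from (T-reach-suc H (suc r) u v) (inj₂ (z , reach-step r uw wz , zv))

  reach-complete : ∀ {r u v ℓ} → Walk G u v ℓ → ℓ ≤ r → T (reach H r u v)
  reach-complete {r} {u} here _                  = reach-refl r u
  reach-complete {suc r} (step uw wv) (s≤s ℓ≤r) = reach-step r uw (reach-complete wv ℓ≤r)

  reach-sound : ∀ r {u v : V} → T (reach H r u v) → DistLE G r u v
  reach-sound zero {u} {v} uv with toWitness {a? = u ≟ v} uv
  ... | refl = 0 , z≤n , here
  reach-sound (suc r) {u} {v} uv with to (T-reach-suc H r u v) uv
  ... | inj₁ uv′ with reach-sound r uv′
  ...   | ℓ , ℓ≤r , walk = ℓ , m≤n⇒m≤1+n ℓ≤r , walk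
  reach-sound (suc r) uv | inj₂ (w , uw , wv) with reach-sound r uw
  ...   | ℓ , ℓ≤r , walk = suc ℓ , s≤s ℓ≤r , walk-snoc walk (to T-≡ wv)

  T-reach⇔DistLE : ∀ r u v → T (reach H r u v) ⇔ DistLE G r u v
  T-reach⇔DistLE r u v = mk⇔ (reach-sound _) (λ (ℓ , ℓ≤r , walk) → reach-complete walk ℓ≤r)

⊤ᶠ : ∀ {p a b} → Formula p a b
⊤ᶠ = teq empty empty

⋀ : ∀ {p a b m} → (Fin m → Formula p a b) → Formula p a b
⋀ {m = zero}  φ = ⊤ᶠ
⋀ {m = suc m} φ = and (φ fzero) (⋀ (φ ∘ fsuc))

unless : ∀ {p a b} {P : Set} → Dec P → Formula p a b → Formula p a b
unless (yes _) φ = ⊤ᶠ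
unless (no  _) φ = φ

∃ˢ : ∀ {p a b} m → Formula p a (m + b) → Formula p a b
∃ˢ zero    φ = φ
∃ˢ (suc m) φ = ∃ˢ m (ex-s φ)

⋃ : ∀ {p b m} → (Fin m → Term p b) → Term p b
⋃ {m = zero}  t = empty
⋃ {m = suc m} t = union (t fzero) (⋃ (t ∘ fsuc))

module _ {p : ℕ} (G : ColGraph p) where
  private
    ⟦_⟧ : ∀ {b} → Term p b → Vec (Subset (n G)) b → Subset (n G)
    ⟦_⟧ = ⟦_⟧t G

  Sat-⋀ : ∀ {a b m} {φ : Fin m → Formula p a b} {ρ σ} →
          Sat G (⋀ φ) ρ σ ⇔ (∀ i → Sat G (φ i) ρ σ)
  Sat-⋀ {m = zero}      = mk⇔ (λ _ ()) (λ _ → refl)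
  Sat-⋀ {m = suc m} {φ} = mk⇔
    (λ { (h , hs) fzero → h ; (h , hs) (fsuc i) → to (Sat-⋀ {φ = φ ∘ fsuc}) hs i })
    (λ h → h fzero , from (Sat-⋀ {φ = φ ∘ fsuc}) (h ∘ fsuc))

  Sat-unless : ∀ {a b} {P : Set} (P? : Dec P) {φ : Formula p a b} {ρ σ} →
               Sat G (unless P? φ) ρ σ ⇔ (¬ P → Sat G φ ρ σ)
  Sat-unless (yes p) = mk⇔ (λ _ ¬p → contradiction p ¬p) (λ _ → refl)
  Sat-unless (no ¬p) = mk⇔ (λ h _ → h) (λ h → h ¬p)

  Sat-∃ˢ : ∀ {a b} m {φ : Formula p a (m + b)} {ρ σ} →
           Sat G (∃ˢ m φ) ρ σ ⇔ (Σ (Vec (Subset (n G)) m) λ τ → Sat G φ ρ (τ ++ σ))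
  Sat-∃ˢ zero        = mk⇔ ([] ,_) (λ { ([] , h) → h })
  Sat-∃ˢ (suc m) {φ} {ρ} {σ} = mk⇔ to′ from′
    where
    to′ : Sat G (∃ˢ (suc m) φ) ρ σ → Σ (Vec (Subset (n G)) (suc m)) λ τ → Sat G φ ρ (τ ++ σ)
    to′ h with to (Sat-∃ˢ m) h
    ... | τ , X , hX = X ∷ τ , hX
    from′ : (Σ (Vec (Subset (n G)) (suc m)) λ τ → Sat G φ ρ (τ ++ σ)) → Sat G (∃ˢ (suc m) φ) ρ σ
    from′ (X ∷ τ , h) = from (Sat-∃ˢ m) (τ , X , h)

  ∈-⋃ : ∀ {b m} {t : Fin m → Term p b} {σ x} → x ∈ ⟦ ⋃ t ⟧ σ ⇔ (∃[ i ] x ∈ ⟦ t i ⟧ σ)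
  ∈-⋃ {m = zero}              = mk⇔ (λ x∈⊥ → contradiction x∈⊥ ∉⊥) (λ ())
  ∈-⋃ {m = suc m} {t} {σ} {x} = mk⇔ to′ from′
    where
    to′ : x ∈ ⟦ ⋃ t ⟧ σ → ∃[ i ] x ∈ ⟦ t i ⟧ σ
    to′ h with x∈p∪q⁻ _ _ h
    ... | inj₁ h₀ = fzero , h₀
    ... | inj₂ hs = let (i , hi) = to (∈-⋃ {t = t ∘ fsuc}) hs in fsuc i , hi
    from′ : ∃[ i ] x ∈ ⟦ t i ⟧ σ → x ∈ ⟦ ⋃ t ⟧ σ
    from′ (fzero  , h) = x∈p∪q⁺ (inj₁ h)
    from′ (fsuc i , h) = x∈p∪q⁺ (inj₂ (from (∈-⋃ {t = t ∘ fsuc}) (i , h)))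

record IsSetLabeling (G : Graph) (k : ℕ) {s : ℕ} (ds : Vec ℕ s)
                     (X : Vec (Subset (Graph.n G)) k) : Set where
  field
    covering  : ∀ v → ∃[ a ] v ∈ lookup X a
    separated : ∀ i a b {u v} → u ≢ v → DistLE G (suc (toℕ i)) u v →
                u ∈ lookup X a → v ∈ lookup X b → lookup ds i ≤ ∣ toℕ a - toℕ b ∣
open IsSetLabeling

fibres : ∀ {n k} → (Fin n → Fin k) → Vec (Subset n) k
fibres c = tabulate λ a → tabulate λ v → ⌊ c v ≟ a ⌋

∈-fibres : ∀ {n k} (c : Fin n → Fin k) {a v} → v ∈ lookup (fibres c) a ⇔ c v ≡ a
∈-fibres c {a} {v} =
  subst (λ X → v ∈ X ⇔ c v ≡ a) (sym (lookup∘tabulate _ a))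
    (mk⇔ (toWitness ∘ to ∈-tabulate) (from ∈-tabulate ∘ fromWitness))

module _ (G : Graph) {k s : ℕ} {ds : Vec ℕ s} where

  IsLabeling⇒IsSetLabeling : ∀ {c} → IsLabeling G k ds c → IsSetLabeling G k ds (fibres c)
  IsLabeling⇒IsSetLabeling {c} labeling = record
    { covering  = λ v → c v , from (∈-fibres c) refl
    ; separated = λ i a b {u} {v} u≢v uv u∈a v∈b →
        subst₂ (λ a b → lookup ds i ≤ ∣ toℕ a - toℕ b ∣)
          (to (∈-fibres c) u∈a) (to (∈-fibres c) v∈b) (labeling i u v u≢v uv)
    }

  IsSetLabeling⇒HasLabeling : ∀ {X} → IsSetLabeling G k ds X → HasLabeling G k ds
  IsSetLabeling⇒HasLabeling setLabeling = label , λ i u v u≢v uv →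
    separated setLabeling i (label u) (label v) u≢v uv (proj₂ (covering setLabeling u))
      (proj₂ (covering setLabeling v))
    where
    label : Fin (Graph.n G) → Fin k
    label = proj₁ ∘ covering setLabeling

  ∃IsSetLabeling⇔HasLabeling : ∃ (IsSetLabeling G k ds) ⇔ HasLabeling G k ds
  ∃IsSetLabeling⇔HasLabeling = mk⇔ (IsSetLabeling⇒HasLabeling ∘ proj₂)
    (λ (c , labeling) → fibres c , IsLabeling⇒IsSetLabeling labeling)

class : ∀ {k} → Fin k → Term 0 (k + 0)
class a = svar (a ↑ˡ 0)

coverage : ∀ k → Formula 0 0 (k + 0)
coverage k = teq (compl (⋃ class)) empty

separation : ∀ {k s} → Vec ℕ s → Fin s → Fin k → Fin k → Formula 0 0 (k + 0)
separation ds i a b = unless (lookup ds i ≤? ∣ toℕ a - toℕ b ∣)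
  (teq (inter (class b) (nbhd 1 (suc (toℕ i)) (class a))) empty)

labelingConditions : ∀ k {s} → Vec ℕ s → Formula 0 0 (k + 0)
labelingConditions k ds = and (coverage k) (⋀ λ i → ⋀ λ a → ⋀ λ b → separation ds i a b)

labelingSentence : ∀ k {s} → Vec ℕ s → Sentence 0
labelingSentence k ds = ∃ˢ k (labelingConditions k ds)

module _ (G : Graph) {k s : ℕ} {ds : Vec ℕ s} where
  private
    H = plain G
    S = Subset (Graph.n G)
    ⟦_⟧ : Term 0 (k + 0) → Vec S (k + 0) → S
    ⟦_⟧ = ⟦_⟧t H

  ∈-class : ∀ (τ : Vec S k) a {v} → v ∈ ⟦ class a ⟧ (τ ++ []) ⇔ v ∈ lookup τ a
  ∈-class τ a {v} = subst (λ X → v ∈ X ⇔ v ∈ lookup τ a) (sym (lookup-++ˡ τ [] a)) (mk⇔ id id)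

  Sat-coverage : ∀ {τ : Vec S k} →
                 Sat H (coverage k) [] (τ ++ []) ⇔ (∀ v → ∃[ a ] v ∈ lookup τ a)
  Sat-coverage {τ} = mk⇔
    (λ cov v → let (a , v∈a) = to (∈-⋃ H) (x∉∁p⇒x∈p (λ v∈∁ → to ≡⊥⇔Empty cov (v , v∈∁)))
               in a , to (∈-class τ a) v∈a)
    (λ cov → from ≡⊥⇔Empty λ (v , v∈∁) →
      let (a , v∈a) = cov v in x∈∁p⇒x∉p v∈∁ (from (∈-⋃ H) (a , from (∈-class τ a) v∈a)))

  Sat-separation : ∀ {τ : Vec S k} i a b →
    Sat H (separation ds i a b) [] (τ ++ []) ⇔
    (∀ {u v} → u ≢ v → DistLE G (suc (toℕ i)) u v →
      u ∈ lookup τ a → v ∈ lookup τ b → lookup ds i ≤ ∣ toℕ a - toℕ b ∣)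
  Sat-separation {τ} i a b = mk⇔ to′ from′
    where
    r : ℕ
    r = suc (toℕ i)
    close? : Dec (lookup ds i ≤ ∣ toℕ a - toℕ b ∣)
    close? = lookup ds i ≤? ∣ toℕ a - toℕ b ∣
    Separated : Set
    Separated = ∀ {u v} → u ≢ v → DistLE G r u v →
                u ∈ lookup τ a → v ∈ lookup τ b → lookup ds i ≤ ∣ toℕ a - toℕ b ∣

    ∈-N-class : ∀ {v} → v ∈ N H 1 r (⟦ class a ⟧ (τ ++ [])) ⇔
                (∃[ u ] u ≢ v × DistLE G r u v × u ∈ lookup τ a)
    ∈-N-class {v} = mk⇔
      (λ v∈N → let (u , u≢v , uv , u∈a) = to (∈-N₁ H {r = r}) v∈N
               in u , u≢v , to (T-reach⇔DistLE G r u v) uv , to (∈-class τ a) u∈a)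
      (λ (u , u≢v , uv , u∈a) →
        from (∈-N₁ H {r = r}) (u , u≢v , from (T-reach⇔DistLE G r u v) uv , from (∈-class τ a) u∈a))

    to′ : Sat H (separation ds i a b) [] (τ ++ []) → Separated
    to′ sep {u} {v} u≢v uv u∈a v∈b = decidable-stable close? λ close →
      to ≡⊥⇔Empty (to (Sat-unless H close?) sep close)
        (v , x∈p∩q⁺ (from (∈-class τ b) v∈b , from ∈-N-class (u , u≢v , uv , u∈a)))

    from′ : Separated → Sat H (separation ds i a b) [] (τ ++ [])
    from′ sep = from (Sat-unless H close?) λ close → from ≡⊥⇔Empty λ (v , v∈) →
      let (v∈b , v∈N)           = x∈p∩q⁻ _ _ v∈
          (u , u≢v , uv , u∈a) = to ∈-N-class v∈N
      in close (sep u≢v uv u∈a (to (∈-class τ b) v∈b))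

  Sat-labelingConditions : ∀ {τ : Vec S k} →
    Sat H (labelingConditions k ds) [] (τ ++ []) ⇔ IsSetLabeling G k ds τ
  Sat-labelingConditions = mk⇔
    (λ (cov , sep) → record
      { covering  = to Sat-coverage cov
      ; separated = λ i a b → to (Sat-separation i a b)
                                  (to (Sat-⋀ H) (to (Sat-⋀ H) (to (Sat-⋀ H) sep i) a) b)
      })
    (λ setLabeling →
      from Sat-coverage (covering setLabeling) ,
      from (Sat-⋀ H) λ i → from (Sat-⋀ H) λ a → from (Sat-⋀ H) λ b →
        from (Sat-separation i a b) (separated setLabeling i a b))

  Sat-labelingSentence : H ⊨ labelingSentence k ds ⇔ ∃ (IsSetLabeling G k ds)
  Sat-labelingSentence = mk⇔
    (λ h → let (τ , conditions) = to ∃ˢ-conditions h in τ , to Sat-labelingConditions conditions)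
    (λ (τ , setLabeling) → from ∃ˢ-conditions (τ , from Sat-labelingConditions setLabeling))
    where
    ∃ˢ-conditions : H ⊨ labelingSentence k ds ⇔
                    (Σ (Vec S k) λ τ → Sat H (labelingConditions k ds) [] (τ ++ []))
    ∃ˢ-conditions = Sat-∃ˢ H k {φ = labelingConditions k ds} {ρ = []} {σ = []}

proposition6p5 : (k : ℕ) → k ≥ 1 → (s : ℕ) (ds : Vec ℕ s) → All (_≥ 1) ds →
    Σ (Sentence 0) λ φ → (G : Graph) → (plain G ⊨ φ) ⇔ HasLabeling G k ds
proposition6p5 k _ s ds _ =
  labelingSentence k ds , λ G → ∃IsSetLabeling⇔HasLabeling G {ds = ds} ⇔-∘ Sat-labelingSentence G
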